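{- Let $A$, $B$, $C$ be Boolean terms and consider all probability distributions $\Pr$ on $\{\mathsf{T},\mathsf{F}\}^3$ (joint truth values of $A,B,C$). Let the major premise be $AiB$ or $BiA$, and let the minor premise be $B\mathfrak{n}C$ or $C\mathfrak{n}B$ with $\mathfrak{n}\in\{e,\acute{e}\}$ (all four figure arrangements). Then: (1) for no type $\mathfrak{s}\in\{a,\acute{a},e,\acute{e},i,o,u\}$ does every distribution satisfying the two premises satisfy $A\mathfrak{s}C$; (2) every distribution satisfying the two premises satisfies $Ai\overline{C}$, i.e. $\Pr(A\text{ true},C\text{ false})>0$.
   Context: For terms $P,Q\in\{A,B,C\}$, write $\Pr(P,Q)$ for the probability that $P$ and $Q$ are both true and $\Pr(Q)$ for the probability that $Q$ is true. Categorical statements (predicate $P$ first, subject $Q$ last): $PaQ$ iff $\Pr(P,Q)=\Pr(Q)$; $P\acute{a}Q$ iff $\Pr(P,Q)=\Pr(Q)$ and $\Pr(Q)>0$; $PeQ$ iff $\Pr(P,Q)=0$; $P\acute{e}Q$ iff $\Pr(P,Q)=0$ and $\Pr(Q)>0$; $PiQ$ iff $\Pr(P,Q)>0$; $PoQ$ iff $\Pr(P,Q)<\Pr(Q)$; $PuQ$ iff $0<\Pr(P,Q)<\Pr(Q)$. The statement $Ai\overline{C}$ means the probability that $A$ is true and $C$ is false is positive.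
   Formalization: The probability distributions on {T,F}^3 take rational values instead of real ones. -}

module Defs where

open import Data.Bool using (Bool; true; false; if_then_else_; _∧_; not)
open import Data.Product using (_×_; _,_)
open import Data.Sum using (_⊎_)
open import Data.List using (List; []; _∷_; foldr; map)
open import Data.Rational using (ℚ; 0ℚ; 1ℚ; _+_; _≤_; _<_)
open import Relation.Binary.PropositionalEquality using (_≡_)

World : Set
World = Bool × Bool × Bool

allWorlds : List World
allWorlds =
  (true , true , true) ∷ (false , true , true) ∷
  (true , true , false) ∷ (false , true , false) ∷
  (true , false , true) ∷ (false , false , true) ∷
  (true , false , false) ∷ (false , false , false) ∷ []

record Dist : Set where
  field
    p      : World → ℚ
    nonneg : ∀ w → 0ℚ ≤ p w
    total  : foldr (λ w s → p w + s) 0ℚ allWorlds ≡ 1ℚ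
open Dist public

Event : Set
Event = World → Bool

A B C : Event
A (a , b , c) = a
B (a , b , c) = b
C (a , b , c) = c

∁ : Event → Event
∁ P w = not (P w)

Pr : Dist → Event → ℚ
Pr d Q = foldr (λ w s → (if Q w then p d w else 0ℚ) + s) 0ℚ allWorlds

Pr₂ : Dist → Event → Event → ℚ
Pr₂ d P Q = Pr d (λ w → P w ∧ Q w)

data SType : Set where
  a á e é i o u : SType

-- ⟦ s ⟧ d P Q  means  P s Q  (predicate P first, subject Q last)
⟦_⟧ : SType → Dist → Event → Event → Set
⟦ a ⟧ d P Q = Pr₂ d P Q ≡ Pr d Q
⟦ á ⟧ d P Q = (Pr₂ d P Q ≡ Pr d Q) × (0ℚ < Pr d Q)
⟦ e ⟧ d P Q = Pr₂ d P Q ≡ 0ℚ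
⟦ é ⟧ d P Q = (Pr₂ d P Q ≡ 0ℚ) × (0ℚ < Pr d Q)
⟦ i ⟧ d P Q = 0ℚ < Pr₂ d P Q
⟦ o ⟧ d P Q = Pr₂ d P Q < Pr d Q
⟦ u ⟧ d P Q = (0ℚ < Pr₂ d P Q) × (Pr₂ d P Q < Pr d Q)

data NegType : Set where
  nE nÉ : NegType

toSType : NegType → SType
toSType nE = e
toSType nÉ = é

Major : Bool → Dist → Set
Major false d = ⟦ i ⟧ d A B
Major true  d = ⟦ i ⟧ d B A

Minor : Bool → NegType → Dist → Set
Minor false n d = ⟦ toSType n ⟧ d B C
Minor true  n d = ⟦ toSType n ⟧ d C B

-- Pr(A,B) is covered by Pr(A,C̄) + Pr(B,C), so A i B and B e C force A i C̄.
-- Nothing stronger about A and C follows: the premises hold both in a model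
-- where A and C are disjoint with C possible (refuting a, á, i, u) and in one
-- where C implies A (refuting e, é, o).
module Submission where

open import Defs
open import Algebra.Bundles using (CommutativeMonoid)
open import Data.Bool using (Bool; true; false; T; if_then_else_; _∧_)
open import Data.List using (List; []; _∷_; foldr)
open import Data.Product using (_×_; _,_; uncurry; ∃-syntax)
open import Data.Sum using (_⊎_; inj₁; inj₂)
open import Data.Rational using (ℚ; 0ℚ; ½; _+_; _≤_; _<_; _<?_)
open import Data.Rational.Properties
open import Data.Unit using (tt)
open import Function.Bundles using (_⇔_; mk⇔; Equivalence)
open import Relation.Nullary using (¬_)
open import Relation.Nullary.Decidable using (toWitness)
open import Relation.Binary.PropositionalEquality using (refl; cong; sym)

open import Algebra.Properties.CommutativeSemigroup
  (CommutativeMonoid.commutativeSemigroup +-0-commutativeMonoid) using (interchange)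

weight : Dist → Event → World → ℚ
weight d Q w = if Q w then p d w else 0ℚ

mass : Dist → Event → List World → ℚ
mass d Q = foldr (λ w s → weight d Q w + s) 0ℚ

if-nonneg : ∀ {x} → 0ℚ ≤ x → ∀ b → 0ℚ ≤ (if b then x else 0ℚ)
if-nonneg 0≤x true  = 0≤x
if-nonneg 0≤x false = ≤-refl

if-subadditive : ∀ {x} → 0ℚ ≤ x → ∀ r q s → (T r → T q ⊎ T s) →
  (if r then x else 0ℚ) ≤ (if q then x else 0ℚ) + (if s then x else 0ℚ)
if-subadditive     0≤x false q     s     _ = +-mono-≤ (if-nonneg 0≤x q) (if-nonneg 0≤x s)
if-subadditive {x} 0≤x true  true  s     _ =
  ≤-trans (≤-reflexive (sym (+-identityʳ x))) (+-monoʳ-≤ x (if-nonneg 0≤x s))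
if-subadditive {x} _   true  false true  _ = ≤-reflexive (sym (+-identityˡ x))
if-subadditive     _   true  false false r⇒q⊎s with r⇒q⊎s tt
... | inj₁ ()
... | inj₂ ()

mass-subadditive : ∀ d {R P Q : Event} → (∀ w → T (R w) → T (P w) ⊎ T (Q w)) →
  ∀ ws → mass d R ws ≤ mass d P ws + mass d Q ws
mass-subadditive d                 cover []       = ≤-refl
mass-subadditive d {R} {P} {Q} cover (w ∷ ws) = ≤-trans
  (+-mono-≤ (if-subadditive (nonneg d w) (R w) (P w) (Q w) (cover w))
            (mass-subadditive d {R} {P} {Q} cover ws))
  (≤-reflexive (interchange (weight d P w) (weight d Q w) (mass d P ws) (mass d Q ws)))

Pr-subadditive : ∀ d {R P Q : Event} → (∀ w → T (R w) → T (P w) ⊎ T (Q w)) →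
  Pr d R ≤ Pr d P + Pr d Q
Pr-subadditive d cover = mass-subadditive d cover allWorlds

AiB∧BeC⇒AiC̄ : ∀ {d} → ⟦ i ⟧ d A B → ⟦ e ⟧ d B C → ⟦ i ⟧ d A (∁ C)
AiB∧BeC⇒AiC̄ {d} AiB BeC = <-≤-trans AiB (begin
  Pr₂ d A B                   ≤⟨ Pr-subadditive d cover ⟩
  Pr₂ d A (∁ C) + Pr₂ d B C   ≡⟨ cong (Pr₂ d A (∁ C) +_) BeC ⟩
  Pr₂ d A (∁ C) + 0ℚ          ≡⟨ +-identityʳ _ ⟩
  Pr₂ d A (∁ C)               ∎)
  where
  open ≤-Reasoning
  cover : ∀ w → T (A w ∧ B w) → T (A w ∧ ∁ C w) ⊎ T (B w ∧ C w)
  cover (true , true , true)  _ = inj₂ tt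
  cover (true , true , false) _ = inj₁ tt

-- Pr₂ is evaluated world by world, so for the concrete terms A, B, C the
-- conversions P i Q ↔ Q i P and P e Q ↔ Q e P hold definitionally.
Major⇔AiB : ∀ majSw {d} → Major majSw d ⇔ ⟦ i ⟧ d A B
Major⇔AiB false = mk⇔ (λ h → h) (λ h → h)
Major⇔AiB true  = mk⇔ (λ h → h) (λ h → h)

Minor⇒BeC : ∀ minSw n {d} → Minor minSw n d → ⟦ e ⟧ d B C
Minor⇒BeC false nE BeC       = BeC
Minor⇒BeC false nÉ (BeC , _) = BeC
Minor⇒BeC true  nE CeB       = CeB
Minor⇒BeC true  nÉ (CeB , _) = CeB

Premises : Bool → Bool → NegType → Dist → Set
Premises majSw minSw n d = Major majSw d × Minor minSw n d

PremisesInAllFigures : Dist → Set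
PremisesInAllFigures d = ∀ majSw minSw n → Premises majSw minSw n d

premisesInAllFigures : ∀ {d} → ⟦ i ⟧ d A B → ⟦ e ⟧ d B C →
  0ℚ < Pr d B → 0ℚ < Pr d C → PremisesInAllFigures d
premisesInAllFigures {d} AiB BeC B>0 C>0 majSw minSw n =
  Equivalence.from (Major⇔AiB majSw {d}) AiB , minor minSw n
  where
  minor : ∀ minSw n → Minor minSw n d
  minor false nE = BeC
  minor false nÉ = BeC , C>0
  minor true  nE = BeC
  minor true  nÉ = BeC , B>0

0<½ : 0ℚ < ½
0<½ = toWitness {a? = 0ℚ <? ½} tt

halfOn : Event → World → ℚ
halfOn E w = if E w then ½ else 0ℚ

halfOn-nonneg : ∀ E w → 0ℚ ≤ halfOn E w
halfOn-nonneg E w = if-nonneg (<⇒≤ 0<½) (E w)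

disjointSupport : Event
disjointSupport (true  , true  , false) = true
disjointSupport (false , false , true)  = true
disjointSupport _                       = false

nestedSupport : Event
nestedSupport (true , true  , false) = true
nestedSupport (true , false , true)  = true
nestedSupport _                      = false

disjointModel nestedModel : Dist
disjointModel = record
  { p = halfOn disjointSupport ; nonneg = halfOn-nonneg disjointSupport ; total = refl }
nestedModel = record
  { p = halfOn nestedSupport ; nonneg = halfOn-nonneg nestedSupport ; total = refl }

disjointModel-premises : PremisesInAllFigures disjointModel
disjointModel-premises = premisesInAllFigures 0<½ refl 0<½ 0<½

nestedModel-premises : PremisesInAllFigures nestedModel
nestedModel-premises = premisesInAllFigures 0<½ refl 0<½ 0<½

counterexample : (s : SType) → ∃[ d ] (PremisesInAllFigures d × ¬ ⟦ s ⟧ d A C)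
counterexample a = disjointModel , disjointModel-premises , λ ()
counterexample á = disjointModel , disjointModel-premises , λ ()
counterexample i = disjointModel , disjointModel-premises , <-irrefl refl
counterexample u = disjointModel , disjointModel-premises , λ (AiC , _) → <-irrefl refl AiC
counterexample e = nestedModel   , nestedModel-premises   , λ ()
counterexample é = nestedModel   , nestedModel-premises   , λ ()
counterexample o = nestedModel   , nestedModel-premises   , <-irrefl refl

mainTheorem4 : (majSw minSw : Bool) (n : NegType) →
    ((s : SType) → ¬ ((d : Dist) → Major majSw d → Minor minSw n d → ⟦ s ⟧ d A C))
    × ((d : Dist) → Major majSw d → Minor minSw n d → ⟦ i ⟧ d A (∁ C))
mainTheorem4 majSw minSw n = noConclusion , AiC̄
  where
  noConclusion : (s : SType) → ¬ ((d : Dist) → Major majSw d → Minor minSw n d → ⟦ s ⟧ d A C)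
  noConclusion s valid with counterexample s
  ... | d , premises , ¬AsC = ¬AsC (uncurry (valid d) (premises majSw minSw n))
  AiC̄ : (d : Dist) → Major majSw d → Minor minSw n d → ⟦ i ⟧ d A (∁ C)
  AiC̄ d major minor =
    AiB∧BeC⇒AiC̄ {d} (Equivalence.to (Major⇔AiB majSw {d}) major) (Minor⇒BeC minSw n {d} minor)
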